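{- Let $1\leq t\leq k-2$ and $2k\leq n$, let $\mathcal{F}\subseteq\binom{[n]}{k}$ be a maximal $t$-intersecting family with $\tau_t(\mathcal{F})=t+1$, and let $\mathcal{T}=\{T\in\binom{[n]}{t+1}: |T\cap F|\geq t \text{ for all } F\in\mathcal{F}\}$. Suppose $\tau_t(\mathcal{T})=t+1$ and $\mathcal{T}=\binom{Z}{t+1}$ for some $(t+2)$-subset $Z$ of $[n]$. Then $\mathcal{F}=\mathcal{H}_2(Z)$, where $\mathcal{H}_2(Z)=\{F\in\binom{[n]}{k}: |F\cap Z|\geq t+1\}$.
   Context: $\binom{[n]}{k}$ denotes the family of $k$-subsets of $[n]=\{1,\ldots,n\}$. A family $\mathcal{G}$ of sets is $t$-intersecting if $|A\cap B|\geq t$ for all $A,B\in\mathcal{G}$. "Maximal" means maximal under inclusion among $t$-intersecting subfamilies of $\binom{[n]}{k}$. The $t$-covering number $\tau_t(\mathcal{G})$ of a family $\mathcal{G}$ of subsets of $[n]$ is the minimum size of a subset $T\subseteq[n]$ with $|T\cap G|\geq t$ for all $G\in\mathcal{G}$. -}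

module Defs where

open import Level using (0ℓ)
open import Data.Nat using (ℕ; suc; _≤_)
open import Data.Fin.Subset using (Subset; ∣_∣; _∩_; _⊆_)
open import Data.Product using (_×_; ∃-syntax)
open import Relation.Binary.PropositionalEquality using (_≡_)
open import Relation.Unary using (Pred)
open import Function.Bundles using (_⇔_)

Family : ℕ → Set₁
Family n = Pred (Subset n) 0ℓ

IsUniform : ∀ {n} → ℕ → Family n → Set
IsUniform k 𝓕 = ∀ F → 𝓕 F → ∣ F ∣ ≡ k

IsTIntersecting : ∀ {n} → ℕ → Family n → Set
IsTIntersecting t 𝓖 = ∀ A B → 𝓖 A → 𝓖 B → t ≤ ∣ A ∩ B ∣

FamSubset : ∀ {n} → Family n → Family n → Set
FamSubset 𝓕 𝓖 = ∀ F → 𝓕 F → 𝓖 F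

IsMaximalTIntersecting : ∀ {n} → ℕ → ℕ → Family n → Set₁
IsMaximalTIntersecting t k 𝓕 =
  IsUniform k 𝓕 × IsTIntersecting t 𝓕 ×
  (∀ (𝓖 : Family _) → IsUniform k 𝓖 → IsTIntersecting t 𝓖 →
     FamSubset 𝓕 𝓖 → FamSubset 𝓖 𝓕)

IsTCover : ∀ {n} → ℕ → Family n → Subset n → Set
IsTCover t 𝓖 T = ∀ G → 𝓖 G → t ≤ ∣ T ∩ G ∣

CoveringNumberIs : ∀ {n} → ℕ → Family n → ℕ → Set
CoveringNumberIs t 𝓖 m =
  (∃[ T ] (IsTCover t 𝓖 T × ∣ T ∣ ≡ m)) ×
  (∀ T → IsTCover t 𝓖 T → m ≤ ∣ T ∣)

CoverFamily : ∀ {n} → ℕ → Family n → Family n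
CoverFamily t 𝓕 T = (∣ T ∣ ≡ suc t) × IsTCover t 𝓕 T

Binom : ∀ {n} → Subset n → ℕ → Family n
Binom Z r T = (T ⊆ Z) × (∣ T ∣ ≡ r)

H₂ : ∀ {n} → ℕ → ℕ → Subset n → Family n
H₂ t k Z F = (∣ F ∣ ≡ k) × (suc t ≤ ∣ F ∩ Z ∣)

FamEq : ∀ {n} → Family n → Family n → Set
FamEq 𝓕 𝓖 = ∀ F → 𝓕 F ⇔ 𝓖 F

module Submission where

-- Write 𝒯 for the family of (t+1)-sets that t-cover 𝓕; by
-- hypothesis 𝒯 = binom(Z, t+1) with |Z| = t+2.
--
--   𝓕 ⊆ H₂(Z): if F ∈ 𝓕 missed Z, any (t+1)-subset of Z would meet F in
--     nothing, although it t-covers F.  Otherwise delete a point of Z ∩ F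
--     from Z; the remaining (t+1)-set T t-covers F, so |F ∩ Z| = |F ∩ T|+1 ≥ t+1.
--   H₂(Z) ⊆ 𝓕: every G ∈ H₂(Z) contains a (t+1)-subset of Z, hence a member
--     of 𝒯, so G t-intersects every member of 𝓕; and H₂(Z) is itself
--     t-intersecting since two (t+1)-subsets of the (t+2)-set Z share t
--     points.  By maximality 𝓕 therefore absorbs H₂(Z).

open import Defs
open import Data.Nat using (ℕ; suc; _≤_; _+_; _*_)
open import Data.Fin.Subset using (Subset; ∣_∣)
open import Relation.Binary.PropositionalEquality using (_≡_)

open import Data.Nat using (zero; z≤n; s≤s; _≤?_)
open import Data.Nat.Properties
open import Data.Fin.Subset using (_∩_; _⊆_; inside; outside)
open import Data.Fin.Subset.Properties
  using (p⊆q⇒∣p∣≤∣q∣; x∈p∩q⁺; x∈p∩q⁻; p∩q⊆p; p∩q⊆q; ∣p∩q∣≤∣p∣; ∩-comm; out⊆; s⊆s; ⊆-refl; ⊆-trans)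
open import Data.Vec using (_∷_; [])
open import Data.Product using (_×_; _,_; proj₁; proj₂; ∃-syntax)
open import Data.Sum using (_⊎_; inj₁; inj₂)
open import Data.Empty using (⊥-elim)
open import Relation.Nullary using (yes; no)
open import Relation.Binary.PropositionalEquality using (refl; sym; trans; subst; cong)
open import Function.Bundles using (mk⇔; Equivalence)

subsetOfSize : ∀ {n} (p : Subset n) m → m ≤ ∣ p ∣ → ∃[ q ] (q ⊆ p × ∣ q ∣ ≡ m)
subsetOfSize [] zero _ = [] , (λ x∈ → x∈) , refl
subsetOfSize (outside ∷ p) m m≤∣p∣ with subsetOfSize p m m≤∣p∣
... | q , q⊆p , ∣q∣ = outside ∷ q , out⊆ q⊆p , ∣q∣
subsetOfSize (inside ∷ p) zero _ with subsetOfSize p zero z≤n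
... | q , q⊆p , ∣q∣ = outside ∷ q , out⊆ q⊆p , ∣q∣
subsetOfSize (inside ∷ p) (suc m) (s≤s m≤∣p∣) with subsetOfSize p m m≤∣p∣
... | q , q⊆p , ∣q∣ = inside ∷ q , s⊆s q⊆p , cong suc ∣q∣

dropCommonPoint : ∀ {n} (Z F : Subset n) m → 1 ≤ ∣ Z ∩ F ∣ → ∣ Z ∣ ≡ suc m →
  ∃[ T ] (T ⊆ Z × ∣ T ∣ ≡ m × suc ∣ T ∩ F ∣ ≡ ∣ Z ∩ F ∣)
dropCommonPoint (inside ∷ Z) (inside ∷ F) m _ ∣Z∣ =
  outside ∷ Z , out⊆ ⊆-refl , suc-injective ∣Z∣ , refl
dropCommonPoint (inside ∷ Z) (outside ∷ F) zero meets ∣Z∣ =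
  ⊥-elim (1+n≰n (≤-trans meets (≤-trans (∣p∩q∣≤∣p∣ Z F) (≤-reflexive (suc-injective ∣Z∣)))))
dropCommonPoint (inside ∷ Z) (outside ∷ F) (suc m) meets ∣Z∣
  with dropCommonPoint Z F m meets (suc-injective ∣Z∣)
... | T , T⊆Z , ∣T∣ , drop = inside ∷ T , s⊆s T⊆Z , cong suc ∣T∣ , drop
dropCommonPoint (outside ∷ Z) (_ ∷ F) m meets ∣Z∣ with dropCommonPoint Z F m meets ∣Z∣
... | T , T⊆Z , ∣T∣ , drop = outside ∷ T , out⊆ T⊆Z , ∣T∣ , drop

-- The traces of A and B on Z overlap in at least |A ∩ Z| + |B ∩ Z| - |Z|
-- points, and that overlap lies in A ∩ B.
traceOverlap : ∀ {n} (A B Z : Subset n) → ∣ A ∩ Z ∣ + ∣ B ∩ Z ∣ ≤ ∣ Z ∣ + ∣ A ∩ B ∣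
traceOverlap [] [] [] = z≤n
traceOverlap (inside ∷ A) (inside ∷ B) (inside ∷ Z)
  rewrite +-suc ∣ A ∩ Z ∣ ∣ B ∩ Z ∣ | +-suc ∣ Z ∣ ∣ A ∩ B ∣ = s≤s (s≤s (traceOverlap A B Z))
traceOverlap (inside ∷ A) (inside ∷ B) (outside ∷ Z) =
  ≤-trans (traceOverlap A B Z) (+-monoʳ-≤ ∣ Z ∣ (n≤1+n _))
traceOverlap (inside ∷ A) (outside ∷ B) (inside ∷ Z) = s≤s (traceOverlap A B Z)
traceOverlap (inside ∷ A) (outside ∷ B) (outside ∷ Z) = traceOverlap A B Z
traceOverlap (outside ∷ A) (inside ∷ B) (inside ∷ Z)
  rewrite +-suc ∣ A ∩ Z ∣ ∣ B ∩ Z ∣ = s≤s (traceOverlap A B Z)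
traceOverlap (outside ∷ A) (inside ∷ B) (outside ∷ Z) = traceOverlap A B Z
traceOverlap (outside ∷ A) (outside ∷ B) (inside ∷ Z) = m≤n⇒m≤1+n (traceOverlap A B Z)
traceOverlap (outside ∷ A) (outside ∷ B) (outside ∷ Z) = traceOverlap A B Z

∣∩∣-monoˡ : ∀ {n} {p q : Subset n} (r : Subset n) → p ⊆ q → ∣ p ∩ r ∣ ≤ ∣ q ∩ r ∣
∣∩∣-monoˡ {p = p} r p⊆q = p⊆q⇒∣p∣≤∣q∣ λ x∈ →
  let x∈p , x∈r = x∈p∩q⁻ p r x∈ in x∈p∩q⁺ (p⊆q x∈p , x∈r)

cover-upward : ∀ {n t} {𝓕 : Family n} {T G : Subset n} →
  T ⊆ G → IsTCover t 𝓕 T → IsTCover t 𝓕 G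
cover-upward T⊆G T-covers A A∈𝓕 = ≤-trans (T-covers A A∈𝓕) (∣∩∣-monoˡ A T⊆G)

largeTraceCovers : ∀ {n t m} {𝓕 : Family n} {Z G : Subset n} →
  FamSubset (Binom Z m) (IsTCover t 𝓕) → m ≤ ∣ G ∩ Z ∣ → IsTCover t 𝓕 G
largeTraceCovers {m = m} {Z = Z} {G} subsetsCover m≤trace
  with subsetOfSize (G ∩ Z) m m≤trace
... | T , T⊆G∩Z , ∣T∣ =
  cover-upward (⊆-trans T⊆G∩Z (p∩q⊆p G Z))
               (subsetsCover T (⊆-trans T⊆G∩Z (p∩q⊆q G Z) , ∣T∣))

membersMeetZ : ∀ {n t m} {𝓕 : Family n} {Z F : Subset n} → 1 ≤ t → ∣ Z ∣ ≡ suc m →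
  FamSubset (Binom Z m) (IsTCover t 𝓕) → 𝓕 F → suc t ≤ ∣ F ∩ Z ∣
membersMeetZ {t = t} {m} {Z = Z} {F} 1≤t ∣Z∣ subsetsCover F∈𝓕 =
  subst (suc t ≤_) (cong ∣_∣ (∩-comm Z F)) meetsZ
  where
  meetsZ : suc t ≤ ∣ Z ∩ F ∣
  meetsZ with 1 ≤? ∣ Z ∩ F ∣
  ... | yes meets with dropCommonPoint Z F m meets ∣Z∣
  ...   | T , T⊆Z , ∣T∣ , drop = subst (suc t ≤_) drop (s≤s (subsetsCover T (T⊆Z , ∣T∣) F F∈𝓕))
  meetsZ | no disjoint with subsetOfSize Z m (≤-trans (n≤1+n m) (≤-reflexive (sym ∣Z∣)))
  ...   | T , T⊆Z , ∣T∣ =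
    ⊥-elim (disjoint (≤-trans 1≤t (≤-trans (subsetsCover T (T⊆Z , ∣T∣) F F∈𝓕) (∣∩∣-monoˡ F T⊆Z))))

_∪ᶠ_ : ∀ {n} → Family n → Family n → Family n
(𝓕 ∪ᶠ 𝓗) X = 𝓕 X ⊎ 𝓗 X

maximalAbsorbs : ∀ {n t k} {𝓕 𝓗 : Family n} → IsMaximalTIntersecting t k 𝓕 →
  IsUniform k 𝓗 → IsTIntersecting t 𝓗 → FamSubset 𝓗 (IsTCover t 𝓕) → FamSubset 𝓗 𝓕
maximalAbsorbs {t = t} {k} {𝓕} {𝓗} (uniform𝓕 , intersecting𝓕 , maximal) uniform𝓗 intersecting𝓗 cross H H∈𝓗 =
  maximal (𝓕 ∪ᶠ 𝓗) uniform intersecting (λ _ → inj₁) H (inj₂ H∈𝓗)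
  where
  uniform : IsUniform k (𝓕 ∪ᶠ 𝓗)
  uniform X (inj₁ X∈𝓕) = uniform𝓕 X X∈𝓕
  uniform X (inj₂ X∈𝓗) = uniform𝓗 X X∈𝓗

  intersecting : IsTIntersecting t (𝓕 ∪ᶠ 𝓗)
  intersecting A B (inj₁ A∈𝓕) (inj₁ B∈𝓕) = intersecting𝓕 A B A∈𝓕 B∈𝓕
  intersecting A B (inj₁ A∈𝓕) (inj₂ B∈𝓗) = subst (t ≤_) (cong ∣_∣ (∩-comm B A)) (cross B B∈𝓗 A A∈𝓕)
  intersecting A B (inj₂ A∈𝓗) (inj₁ B∈𝓕) = cross A A∈𝓗 B B∈𝓕
  intersecting A B (inj₂ A∈𝓗) (inj₂ B∈𝓗) = intersecting𝓗 A B A∈𝓗 B∈𝓗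

-- H₂(Z) is t-intersecting when |Z| = t+2: two (t+1)-traces on Z share t points.
H₂-intersecting : ∀ {n t k} {Z : Subset n} → ∣ Z ∣ ≡ t + 2 → IsTIntersecting t (H₂ t k Z)
H₂-intersecting {t = t} {Z = Z} ∣Z∣ A B (_ , A∩Z) (_ , B∩Z) =
  +-cancelˡ-≤ (t + 2) t ∣ A ∩ B ∣ (begin
    t + 2 + t                   ≡⟨ cong (_+ t) (+-comm t 2) ⟩
    2 + t + t                   ≡⟨ cong suc (sym (+-suc t t)) ⟩
    suc t + suc t               ≤⟨ +-mono-≤ A∩Z B∩Z ⟩
    ∣ A ∩ Z ∣ + ∣ B ∩ Z ∣       ≤⟨ traceOverlap A B Z ⟩
    ∣ Z ∣ + ∣ A ∩ B ∣           ≡⟨ cong (_+ ∣ A ∩ B ∣) ∣Z∣ ⟩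
    t + 2 + ∣ A ∩ B ∣           ∎)
  where open ≤-Reasoning

lemma2p5 : (n k t : ℕ) → 1 ≤ t → t + 2 ≤ k → 2 * k ≤ n →
    (𝓕 : Family n) → IsMaximalTIntersecting t k 𝓕 →
    CoveringNumberIs t 𝓕 (suc t) →
    CoveringNumberIs t (CoverFamily t 𝓕) (suc t) →
    (Z : Subset n) → ∣ Z ∣ ≡ t + 2 →
    FamEq (CoverFamily t 𝓕) (Binom Z (suc t)) →
    FamEq 𝓕 (H₂ t k Z)
lemma2p5 n k t 1≤t _ _ 𝓕 𝓕-maximal _ _ Z ∣Z∣ 𝒯≡binom F = mk⇔ intoH₂ into𝓕
  where
  subsetsCover : FamSubset (Binom Z (suc t)) (IsTCover t 𝓕)
  subsetsCover T T∈binom = proj₂ (Equivalence.from (𝒯≡binom T) T∈binom)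

  intoH₂ : 𝓕 F → H₂ t k Z F
  intoH₂ F∈𝓕 = proj₁ 𝓕-maximal F F∈𝓕
             , membersMeetZ 1≤t (trans ∣Z∣ (+-comm t 2)) subsetsCover F∈𝓕

  into𝓕 : H₂ t k Z F → 𝓕 F
  into𝓕 = maximalAbsorbs 𝓕-maximal (λ _ → proj₁) (H₂-intersecting ∣Z∣)
            (λ G G∈H₂ → largeTraceCovers {G = G} subsetsCover (proj₂ G∈H₂)) F
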